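{- Let $A$ be a $0$-$1$ matrix (possibly with no rows and columns), and let \[P'=\begin{pmatrix} A & \mathbf{0}\\ \mathbf{0} & 1\end{pmatrix},\qquad P=\begin{pmatrix} A & \mathbf{0} & \mathbf{0}\\ \mathbf{0} & 1 & 0\\ \mathbf{0} & 0 & 1\end{pmatrix},\] i.e. $P'$ is obtained from $A$ by adding a new last row and a new last column whose only $1$ entry is at their intersection, and $P$ is obtained from $P'$ in the same way. Then for all positive integers $m,n$, \[ex(P,m,n)=ex(P',m-1,n-1)+m+n-1,\qquad sat(P,m,n)=sat(P',m-1,n-1)+m+n-1.\]
   Context: All matrices are $0$-$1$ matrices; an $m\times n$ matrix has $m$ rows and $n$ columns. The weight of a matrix is its number of $1$ entries. A matrix $M$ contains a $k\times l$ pattern $P$ if there are rows $r_1<\dots<r_k$ and columns $c_1<\dots<c_l$ of $M$ such that $M(r_a,c_b)=1$ whenever $P(a,b)=1$; otherwise $M$ avoids $P$. $ex(P,m,n)$ is the maximum weight of an $m\times n$ matrix avoiding $P$. A matrix $M$ is saturating for $P$ if $M$ avoids $P$ and changing any single $0$ entry of $M$ to $1$ yields a matrix containing $P$. $sat(P,m,n)$ is the minimum weight of an $m\times n$ matrix saturating for $P$. A matrix with zero rows or zero columns has weight $0$, so $ex$ and $sat$ equal $0$ when a dimension is $0$. -}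

module Defs where

open import Data.Nat using (ℕ; zero; suc; _+_; _≤_)
open import Data.Bool using (Bool; true; false; if_then_else_; _∧_)
open import Data.Fin using (Fin; zero; suc; _<_; _≟_)
open import Data.Maybe using (Maybe; just; nothing)
open import Data.Product using (Σ; _×_; ∃)
open import Relation.Binary.PropositionalEquality using (_≡_)
open import Relation.Nullary using (¬_)
open import Relation.Nullary.Decidable using (⌊_⌋)

Matrix : ℕ → ℕ → Set
Matrix m n = Fin m → Fin n → Bool

sumFin : (n : ℕ) → (Fin n → ℕ) → ℕ
sumFin zero    f = 0
sumFin (suc n) f = f zero + sumFin n (λ i → f (suc i))

weight : {m n : ℕ} → Matrix m n → ℕ
weight {m} {n} M = sumFin m (λ i → sumFin n (λ j → if M i j then 1 else 0))

StrictlyIncreasing : {k m : ℕ} → (Fin k → Fin m) → Set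
StrictlyIncreasing f = ∀ a b → a < b → f a < f b

Contains : {k l m n : ℕ} → Matrix k l → Matrix m n → Set
Contains {k} {l} {m} {n} P M =
  Σ (Fin k → Fin m) λ r → Σ (Fin l → Fin n) λ c →
    StrictlyIncreasing r × StrictlyIncreasing c ×
    (∀ a b → P a b ≡ true → M (r a) (c b) ≡ true)

Avoids : {k l m n : ℕ} → Matrix k l → Matrix m n → Set
Avoids P M = ¬ Contains P M

setOne : {m n : ℕ} → Matrix m n → Fin m → Fin n → Matrix m n
setOne M i j r c = if ⌊ r ≟ i ⌋ ∧ ⌊ c ≟ j ⌋ then true else M r c

Saturating : {k l m n : ℕ} → Matrix k l → Matrix m n → Set
Saturating P M = Avoids P M × (∀ i j → M i j ≡ false → Contains P (setOne M i j))

IsEx : {k l : ℕ} → Matrix k l → ℕ → ℕ → ℕ → Set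
IsEx P m n e =
  (Σ (Matrix m n) λ M → Avoids P M × weight M ≡ e) ×
  (∀ (M : Matrix m n) → Avoids P M → weight M ≤ e)

IsSat : {k l : ℕ} → Matrix k l → ℕ → ℕ → ℕ → Set
IsSat P m n s =
  (Σ (Matrix m n) λ M → Saturating P M × weight M ≡ s) ×
  (∀ (M : Matrix m n) → Saturating P M → s ≤ weight M)

initFin : {k : ℕ} → Fin (suc k) → Maybe (Fin k)
initFin {zero}  zero    = nothing
initFin {suc k} zero    = just zero
initFin {suc k} (suc i) with initFin {k} i
... | just a  = just (suc a)
... | nothing = nothing

-- ext A = ( A 0 ; 0 1 ): new last row and column, only 1 at their intersection.
ext : {k l : ℕ} → Matrix k l → Matrix (suc k) (suc l)
ext A i j with initFin i | initFin j
... | just a  | just b  = A a b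
... | nothing | nothing = true
... | just _  | nothing = false
... | nothing | just _  = false

-- Call a 1 of an (m+1) × (n+1) matrix M a core entry if another 1 lies strictly south-east of it,
-- and a frontier entry otherwise.  The core avoids the last row and column, so it lives in the
-- m × n matrix shrink M; if M avoids P then shrink M avoids P′, since the last entry of a copy of
-- P′ in the core has a 1 south-east of it, completing a copy of P.  Conversely, bordering an m × n
-- matrix that avoids P′ by a row and a column of ones adds m + n + 1 ones and creates no copy of P.
-- Pair each cell (i , j) with (i+1 , j+1): either the first has a 1 south-east of it or the
-- second is vacant (a 0 with no 1 south-east of it).  Frontier cells are neither, so there are at
-- most (m+1)(n+1) − mn = m + n + 1 of them.  If M is P-saturating, then shrink M is P′-saturating,
-- no cell of the first row or column is vacant and no pair has both properties, so the count is
-- exact and the frontier has at least m + n + 1 entries.  Hence ex and sat both shift by m + n + 1.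
module Submission where

open import Defs
open import Data.Nat as ℕ using (ℕ; zero; suc; _+_; _∸_; _*_; z≤n; s≤s)
import Data.Nat.Properties as ℕₚ
open import Data.Nat.Solver using (module +-*-Solver)
open import Algebra.Properties.CommutativeSemigroup ℕₚ.+-commutativeSemigroup
  using (interchange; x∙yz≈z∙yx)
open import Data.Bool as Bool using (Bool; true; false; if_then_else_; _∧_; _∨_; not)
import Data.Bool.Properties as Boolₚ
open import Data.Fin as Fin using (Fin; zero; suc; inject₁; fromℕ; _<_; _≤_)
import Data.Fin.Properties as Finₚ
open import Data.Fin.Relation.Unary.Top using (view; ‵fromℕ; ‵inject₁)
open import Data.Maybe using (just; nothing; maybe)
open import Data.Product using (Σ; ∃₂; _×_; _,_; proj₁; uncurry)
open import Data.Sum using (_⊎_; inj₁; inj₂)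
open import Function.Base using (_∘_; id)
open import Function.Bundles using (_⇔_; mk⇔)
open import Relation.Binary.PropositionalEquality
open import Relation.Nullary using (¬_; Dec; yes; no; contradiction)
open import Relation.Nullary.Decidable using (does; _×-dec_; dec-true; dec-false)

private
  variable
    k l m n : ℕ

initFin-inject₁ : (a : Fin k) → initFin (inject₁ a) ≡ just a
initFin-inject₁ {suc k} zero    = refl
initFin-inject₁ {suc k} (suc a) rewrite initFin-inject₁ a = refl

initFin-fromℕ : ∀ k → initFin (fromℕ k) ≡ nothing
initFin-fromℕ zero    = refl
initFin-fromℕ (suc k) rewrite initFin-fromℕ k = refl

inject₁<fromℕ : (a : Fin k) → inject₁ a < fromℕ k
inject₁<fromℕ {k} a = subst (ℕ._<_ _) (sym (Finₚ.toℕ-fromℕ k)) (Finₚ.inject₁ℕ< a)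

fromℕ≮ : (i : Fin (suc k)) → ¬ fromℕ k < i
fromℕ≮ i = ℕₚ.≤⇒≯ (Finₚ.≤fromℕ i)

inject₁-mono-< : {a b : Fin k} → a < b → inject₁ a < inject₁ b
inject₁-mono-< {a = a} {b} = subst₂ ℕ._<_ (sym (Finₚ.toℕ-inject₁ a)) (sym (Finₚ.toℕ-inject₁ b))

inject₁-cancel-< : {a b : Fin k} → inject₁ a < inject₁ b → a < b
inject₁-cancel-< {a = a} {b} = subst₂ ℕ._<_ (Finₚ.toℕ-inject₁ a) (Finₚ.toℕ-inject₁ b)

inject₁<suc : (i : Fin k) → inject₁ i < suc i
inject₁<suc i = Finₚ.≤̄⇒inject₁< Finₚ.≤-refl

inject₁<⇒suc≤ : {i : Fin k} {u : Fin (suc k)} → inject₁ i < u → suc i ≤ u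
inject₁<⇒suc≤ {i = i} = subst (λ t → suc t ℕ.≤ _) (Finₚ.toℕ-inject₁ i)

module _ (A : Matrix k l) where

  ext-inject₁ : ∀ a b → ext A (inject₁ a) (inject₁ b) ≡ A a b
  ext-inject₁ a b rewrite initFin-inject₁ a | initFin-inject₁ b = refl

  ext-corner : ext A (fromℕ k) (fromℕ l) ≡ true
  ext-corner rewrite initFin-fromℕ k | initFin-fromℕ l = refl

  ext-lastColumn : ∀ a → ext A (inject₁ a) (fromℕ l) ≡ false
  ext-lastColumn a rewrite initFin-inject₁ a | initFin-fromℕ l = refl

  ext-lastRow : ∀ b → ext A (fromℕ k) (inject₁ b) ≡ false
  ext-lastRow b rewrite initFin-fromℕ k | initFin-inject₁ b = refl

ind : Bool → ℕ
ind b = if b then 1 else 0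

ind-false : ∀ {b} → b ≡ false → ind b ≡ 0
ind-false refl = refl

sumFin-cong : ∀ n {f g : Fin n → ℕ} → (∀ i → f i ≡ g i) → sumFin n f ≡ sumFin n g
sumFin-cong zero    _ = refl
sumFin-cong (suc n) h = cong₂ _+_ (h zero) (sumFin-cong n (h ∘ suc))

sumFin-+ : ∀ n (f g : Fin n → ℕ) → sumFin n f + sumFin n g ≡ sumFin n (λ i → f i + g i)
sumFin-+ zero    f g = refl
sumFin-+ (suc n) f g = begin
  (f zero + sumFin n (f ∘ suc)) + (g zero + sumFin n (g ∘ suc))
    ≡⟨ interchange (f zero) _ (g zero) _ ⟩
  (f zero + g zero) + (sumFin n (f ∘ suc) + sumFin n (g ∘ suc))
    ≡⟨ cong (f zero + g zero +_) (sumFin-+ n (f ∘ suc) (g ∘ suc)) ⟩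
  (f zero + g zero) + sumFin n (λ i → f (suc i) + g (suc i)) ∎
  where open ≡-Reasoning

sumFin-mono-≤ : ∀ n {f g : Fin n → ℕ} → (∀ i → f i ℕ.≤ g i) → sumFin n f ℕ.≤ sumFin n g
sumFin-mono-≤ zero    _ = z≤n
sumFin-mono-≤ (suc n) h = ℕₚ.+-mono-≤ (h zero) (sumFin-mono-≤ n (h ∘ suc))

sumFin-const : ∀ n c → sumFin n (λ _ → c) ≡ n * c
sumFin-const zero    c = refl
sumFin-const (suc n) c = cong (c +_) (sumFin-const n c)

sumFin-zero : ∀ n {f : Fin n → ℕ} → (∀ i → f i ≡ 0) → sumFin n f ≡ 0
sumFin-zero n h = trans (sumFin-cong n h) (trans (sumFin-const n 0) (ℕₚ.*-zeroʳ n))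

sumFin-ones : ∀ n {f : Fin n → ℕ} → (∀ i → f i ≡ 1) → sumFin n f ≡ n
sumFin-ones n h = trans (sumFin-cong n h) (trans (sumFin-const n 1) (ℕₚ.*-identityʳ n))

sumFin-last : ∀ n (f : Fin (suc n) → ℕ) → sumFin (suc n) f ≡ sumFin n (f ∘ inject₁) + f (fromℕ n)
sumFin-last zero    f = ℕₚ.+-comm (f zero) 0
sumFin-last (suc n) f =
  trans (cong (f zero +_) (sumFin-last n (f ∘ suc))) (sym (ℕₚ.+-assoc (f zero) _ _))

Σ² : (Fin m → Fin n → ℕ) → ℕ
Σ² {m} {n} f = sumFin m (λ i → sumFin n (f i))

Σ²-cong : {f g : Fin m → Fin n → ℕ} → (∀ i j → f i j ≡ g i j) → Σ² f ≡ Σ² g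
Σ²-cong {m} {n} h = sumFin-cong m (λ i → sumFin-cong n (h i))

Σ²-+ : (f g : Fin m → Fin n → ℕ) → Σ² f + Σ² g ≡ Σ² (λ i j → f i j + g i j)
Σ²-+ {m} {n} f g = trans (sumFin-+ m _ _) (sumFin-cong m (λ i → sumFin-+ n (f i) (g i)))

Σ²-mono-≤ : {f g : Fin m → Fin n → ℕ} → (∀ i j → f i j ℕ.≤ g i j) → Σ² f ℕ.≤ Σ² g
Σ²-mono-≤ {m} {n} h = sumFin-mono-≤ m (λ i → sumFin-mono-≤ n (h i))

Σ²-ones : ∀ m n → Σ² {m} {n} (λ _ _ → 1) ≡ m * n
Σ²-ones m n = trans (sumFin-cong m (λ _ → sumFin-ones n (λ _ → refl))) (sumFin-const m n)

weight-+ : (X Y : Matrix m n) → weight X + weight Y ≡ Σ² (λ i j → ind (X i j) + ind (Y i j))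
weight-+ X Y = Σ²-+ (λ i j → ind (X i j)) (λ i j → ind (Y i j))

weight-partition : (S B C : Matrix m n) →
  (∀ i j → ind (S i j) + (ind (B i j) + ind (C i j)) ≡ 1) → weight S + (weight B + weight C) ≡ m * n
weight-partition {m} {n} S B C h = begin
  weight S + (weight B + weight C)
    ≡⟨ cong (weight S +_) (weight-+ B C) ⟩
  weight S + Σ² (λ i j → ind (B i j) + ind (C i j))
    ≡⟨ Σ²-+ (λ i j → ind (S i j)) (λ i j → ind (B i j) + ind (C i j)) ⟩
  Σ² (λ i j → ind (S i j) + (ind (B i j) + ind (C i j)))
    ≡⟨ Σ²-cong h ⟩
  Σ² {m} {n} (λ _ _ → 1)
    ≡⟨ Σ²-ones m n ⟩
  m * n ∎
  where open ≡-Reasoning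

weight-∨ : (X Y : Matrix m n) → (∀ i j → X i j ∨ Y i j ≡ true) → m * n ℕ.≤ weight X + weight Y
weight-∨ {m} {n} X Y h = begin
  m * n                                   ≡⟨ Σ²-ones m n ⟨
  Σ² {m} {n} (λ _ _ → 1)                  ≤⟨ Σ²-mono-≤ (λ i j → ind-∨ (X i j) (Y i j) (h i j)) ⟩
  Σ² (λ i j → ind (X i j) + ind (Y i j))  ≡⟨ weight-+ X Y ⟨
  weight X + weight Y                     ∎
  where
  open ℕₚ.≤-Reasoning
  ind-∨ : ∀ a b → a ∨ b ≡ true → 1 ℕ.≤ ind a + ind b
  ind-∨ true  _    _ = s≤s z≤n
  ind-∨ false true _ = s≤s z≤n

weight-∧ : (X Y : Matrix m n) → (∀ i j → X i j ∧ Y i j ≡ false) → weight X + weight Y ℕ.≤ m * n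
weight-∧ {m} {n} X Y h = begin
  weight X + weight Y                     ≡⟨ weight-+ X Y ⟩
  Σ² (λ i j → ind (X i j) + ind (Y i j))  ≤⟨ Σ²-mono-≤ (λ i j → ind-∧ (X i j) (Y i j) (h i j)) ⟩
  Σ² {m} {n} (λ _ _ → 1)                  ≡⟨ Σ²-ones m n ⟩
  m * n                                   ∎
  where
  open ℕₚ.≤-Reasoning
  ind-∧ : ∀ a b → a ∧ b ≡ false → ind a + ind b ℕ.≤ 1
  ind-∧ true  false _ = s≤s z≤n
  ind-∧ false true  _ = s≤s z≤n
  ind-∧ false false _ = z≤n

weight-split : (M s : Matrix m n) →
  weight M ≡ weight (λ i j → M i j ∧ s i j) + weight (λ i j → M i j ∧ not (s i j))
weight-split {m} {n} M s = sym (trans (weight-+ (λ i j → M i j ∧ s i j) _)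
                                      (Σ²-cong {m} {n} (λ i j → ind-split (M i j) (s i j))))
  where
  ind-split : ∀ a b → ind (a ∧ b) + ind (a ∧ not b) ≡ ind a
  ind-split true  true  = refl
  ind-split true  false = refl
  ind-split false _     = refl

topLeft : Matrix (suc m) (suc n) → Matrix m n
topLeft M i j = M (inject₁ i) (inject₁ j)

bottomRight : Matrix (suc m) (suc n) → Matrix m n
bottomRight M i j = M (suc i) (suc j)

module _ (M : Matrix (suc m) (suc n)) where

  lastColumnWeight lastRowWeight firstColumnWeight firstRowWeight : ℕ
  lastColumnWeight  = sumFin m (λ i → ind (M (inject₁ i) (fromℕ n)))
  lastRowWeight     = sumFin (suc n) (λ j → ind (M (fromℕ m) j))
  firstColumnWeight = sumFin m (λ i → ind (M (suc i) zero))
  firstRowWeight    = sumFin (suc n) (λ j → ind (M zero j))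

  weight-topLeft : weight M ≡ weight (topLeft M) + (lastColumnWeight + lastRowWeight)
  weight-topLeft = begin
    weight M
      ≡⟨ sumFin-last m row ⟩
    sumFin m (row ∘ inject₁) + row (fromℕ m)
      ≡⟨ cong (_+ row (fromℕ m)) (sumFin-cong m (λ i → sumFin-last n (λ j → ind (M (inject₁ i) j)))) ⟩
    sumFin m (λ i → sumFin n (λ j → ind (topLeft M i j)) + ind (M (inject₁ i) (fromℕ n))) + row (fromℕ m)
      ≡⟨ cong (_+ row (fromℕ m)) (sumFin-+ m _ (λ i → ind (M (inject₁ i) (fromℕ n)))) ⟨
    (weight (topLeft M) + lastColumnWeight) + lastRowWeight
      ≡⟨ ℕₚ.+-assoc (weight (topLeft M)) _ _ ⟩
    weight (topLeft M) + (lastColumnWeight + lastRowWeight) ∎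
    where
    open ≡-Reasoning
    row : Fin (suc m) → ℕ
    row i = sumFin (suc n) (λ j → ind (M i j))

  weight-bottomRight : weight M ≡ weight (bottomRight M) + (firstColumnWeight + firstRowWeight)
  weight-bottomRight = begin
    firstRowWeight + sumFin m (λ i → ind (M (suc i) zero) + sumFin n (λ j → ind (bottomRight M i j)))
      ≡⟨ cong (firstRowWeight +_) (sumFin-+ m (λ i → ind (M (suc i) zero)) _) ⟨
    firstRowWeight + (firstColumnWeight + weight (bottomRight M))
      ≡⟨ x∙yz≈z∙yx firstRowWeight firstColumnWeight (weight (bottomRight M)) ⟩
    weight (bottomRight M) + (firstColumnWeight + firstRowWeight) ∎
    where open ≡-Reasoning

  weight-topLeft-≤ : weight (topLeft M) ℕ.≤ weight M
  weight-topLeft-≤ = ℕₚ.≤-trans (ℕₚ.m≤m+n _ _) (ℕₚ.≤-reflexive (sym weight-topLeft))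

  weight-bottomRight-≤ : weight (bottomRight M) ℕ.≤ weight M
  weight-bottomRight-≤ = ℕₚ.≤-trans (ℕₚ.m≤m+n _ _) (ℕₚ.≤-reflexive (sym weight-bottomRight))

  weight-topLeft-≡ : (∀ i → M i (fromℕ n) ≡ false) → (∀ j → M (fromℕ m) j ≡ false) →
    weight M ≡ weight (topLeft M)
  weight-topLeft-≡ lastColumn lastRow = trans weight-topLeft (trans
    (cong₂ (λ a b → weight (topLeft M) + (a + b))
      (sumFin-zero m (ind-false ∘ lastColumn ∘ inject₁)) (sumFin-zero (suc n) (ind-false ∘ lastRow)))
    (ℕₚ.+-identityʳ _))

  weight-bottomRight-≡ : (∀ i → M i zero ≡ false) → (∀ j → M zero j ≡ false) →
    weight M ≡ weight (bottomRight M)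
  weight-bottomRight-≡ firstColumn firstRow = trans weight-bottomRight (trans
    (cong₂ (λ a b → weight (bottomRight M) + (a + b))
      (sumFin-zero m (ind-false ∘ firstColumn ∘ suc)) (sumFin-zero (suc n) (ind-false ∘ firstRow)))
    (ℕₚ.+-identityʳ _))

weight-shifted-∨ : (X Y : Matrix (suc m) (suc n)) →
  (∀ i j → topLeft X i j ∨ bottomRight Y i j ≡ true) → m * n ℕ.≤ weight X + weight Y
weight-shifted-∨ X Y h = ℕₚ.≤-trans (weight-∨ (topLeft X) (bottomRight Y) h)
  (ℕₚ.+-mono-≤ (weight-topLeft-≤ X) (weight-bottomRight-≤ Y))

weight-shifted-∧ : (X Y : Matrix (suc m) (suc n)) →
  (∀ i j → topLeft X i j ∧ bottomRight Y i j ≡ false) →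
  (∀ i → X i (fromℕ n) ≡ false) → (∀ j → X (fromℕ m) j ≡ false) →
  (∀ i → Y i zero ≡ false) → (∀ j → Y zero j ≡ false) →
  weight X + weight Y ℕ.≤ m * n
weight-shifted-∧ X Y h X-lastColumn X-lastRow Y-firstColumn Y-firstRow =
  subst₂ (λ a b → a + b ℕ.≤ _)
    (sym (weight-topLeft-≡ X X-lastColumn X-lastRow))
    (sym (weight-bottomRight-≡ Y Y-firstColumn Y-firstRow))
    (weight-∧ (topLeft X) (bottomRight Y) h)

_⊆_ : Matrix m n → Matrix m n → Set
M ⊆ N = ∀ x y → M x y ≡ true → N x y ≡ true

_⊆[_,_]_ : Matrix m n → Fin m → Fin n → Matrix m n → Set
M ⊆[ x , y ] N = ∀ x′ y′ → x′ < x → y′ < y → M x′ y′ ≡ true → N x′ y′ ≡ true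

module _ (M : Matrix m n) (x : Fin m) (y : Fin n) where

  setOne-target : setOne M x y x y ≡ true
  setOne-target with x Fin.≟ x | y Fin.≟ y
  ... | yes _   | yes _   = refl
  ... | yes _   | no  y≢y = contradiction refl y≢y
  ... | no  x≢x | _       = contradiction refl x≢x

  ⊆-setOne : M ⊆ setOne M x y
  ⊆-setOne x′ y′ e with x′ Fin.≟ x | y′ Fin.≟ y
  ... | yes _ | yes _ = refl
  ... | yes _ | no  _ = e
  ... | no  _ | _     = e

  setOne-true : ∀ {x′ y′} → setOne M x y x′ y′ ≡ true → (x′ ≡ x × y′ ≡ y) ⊎ M x′ y′ ≡ true
  setOne-true {x′} {y′} e with x′ Fin.≟ x | y′ Fin.≟ y
  ... | yes x′≡x | yes y′≡y = inj₁ (x′≡x , y′≡y)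
  ... | yes _    | no  _    = inj₂ e
  ... | no  _    | _        = inj₂ e

  setOne-⊆ : {N : Matrix m n} → M ⊆ N → N x y ≡ true → setOne M x y ⊆ N
  setOne-⊆ M⊆N Nxy x′ y′ e with setOne-true e
  ... | inj₁ (refl , refl) = Nxy
  ... | inj₂ Mx′y′         = M⊆N x′ y′ Mx′y′

  setOne-⊆[] : {N : Matrix m n} {u : Fin m} {v : Fin n} →
    M ⊆[ u , v ] N → (x < u → y < v → N x y ≡ true) → setOne M x y ⊆[ u , v ] N
  setOne-⊆[] M⊆N Nxy x′ y′ x′<u y′<v e with setOne-true e
  ... | inj₁ (refl , refl) = Nxy x′<u y′<v
  ... | inj₂ Mx′y′         = M⊆N x′ y′ x′<u y′<v Mx′y′

topLeft-setOne : (N : Matrix (suc m) (suc n)) (i : Fin m) (j : Fin n) →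
  topLeft (setOne N (inject₁ i) (inject₁ j)) ⊆ setOne (topLeft N) i j
topLeft-setOne N i j i′ j′ e with setOne-true N (inject₁ i) (inject₁ j) e
... | inj₁ (i′≡i , j′≡j)
  rewrite Finₚ.inject₁-injective i′≡i | Finₚ.inject₁-injective j′≡j = setOne-target (topLeft N) i j
... | inj₂ Ni′j′ = ⊆-setOne (topLeft N) i j i′ j′ Ni′j′

Copy : Matrix k l → Matrix m n → (Fin k → Fin m) → (Fin l → Fin n) → Set
Copy P M r c =
  StrictlyIncreasing r × StrictlyIncreasing c × (∀ a b → P a b ≡ true → M (r a) (c b) ≡ true)

record ContainsNW (P : Matrix k l) (M : Matrix m n) (x : Fin m) (y : Fin n) : Set where
  constructor containsNW
  field
    rows     : Fin k → Fin m
    columns  : Fin l → Fin n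
    copy     : Copy P M rows columns
    rows<    : ∀ a → rows a < x
    columns< : ∀ b → columns b < y

module _ {P : Matrix k l} where

  ContainsNW⇒Contains : {M : Matrix m n} {x : Fin m} {y : Fin n} → ContainsNW P M x y → Contains P M
  ContainsNW⇒Contains (containsNW r c copy _ _) = r , c , copy

  Contains-mono : {M N : Matrix m n} → M ⊆ N → Contains P M → Contains P N
  Contains-mono M⊆N (r , c , r↑ , c↑ , ones) = r , c , r↑ , c↑ , λ a b → M⊆N _ _ ∘ ones a b

  ContainsNW-mono : {M N : Matrix m n} {x : Fin m} {y : Fin n} →
    M ⊆[ x , y ] N → ContainsNW P M x y → ContainsNW P N x y
  ContainsNW-mono M⊆N (containsNW r c (r↑ , c↑ , ones) r<x c<y) =
    containsNW r c (r↑ , c↑ , λ a b → M⊆N _ _ (r<x a) (c<y b) ∘ ones a b) r<x c<y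

  ContainsNW-weaken : {M : Matrix m n} {x x′ : Fin m} {y y′ : Fin n} →
    x ≤ x′ → y ≤ y′ → ContainsNW P M x y → ContainsNW P M x′ y′
  ContainsNW-weaken x≤x′ y≤y′ (containsNW r c copy r<x c<y) =
    containsNW r c copy (λ a → ℕₚ.<-≤-trans (r<x a) x≤x′) (λ b → ℕₚ.<-≤-trans (c<y b) y≤y′)

  topLeft-Contains⇒ContainsNW : {N : Matrix (suc m) (suc n)} →
    Contains P (topLeft N) → ContainsNW P N (fromℕ m) (fromℕ n)
  topLeft-Contains⇒ContainsNW (r , c , r↑ , c↑ , ones) =
    containsNW (inject₁ ∘ r) (inject₁ ∘ c)
      ((λ a b → inject₁-mono-< ∘ r↑ a b) , (λ a b → inject₁-mono-< ∘ c↑ a b) , ones)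
      (inject₁<fromℕ ∘ r) (inject₁<fromℕ ∘ c)

  ContainsNW⇒topLeft-Contains : {N : Matrix (suc m) (suc n)} →
    ContainsNW P N (fromℕ m) (fromℕ n) → Contains P (topLeft N)
  ContainsNW⇒topLeft-Contains {m} {n} {N} (containsNW r c (r↑ , c↑ , ones) r<m c<n) =
    r′ , c′ ,
    (λ a b a<b → inject₁-cancel-< (subst₂ _<_ (sym (r≡ a)) (sym (r≡ b)) (r↑ a b a<b))) ,
    (λ a b a<b → inject₁-cancel-< (subst₂ _<_ (sym (c≡ a)) (sym (c≡ b)) (c↑ a b a<b))) ,
    (λ a b → subst₂ (λ x y → N x y ≡ true) (sym (r≡ a)) (sym (c≡ b)) ∘ ones a b)
    where
    lower : ∀ {t} (x : Fin (suc t)) → x < fromℕ t → Fin t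
    lower {t} x x<t =
      Fin.lower₁ x (λ t≡x → ℕₚ.<-irrefl (trans (sym t≡x) (sym (Finₚ.toℕ-fromℕ t))) x<t)
    r′ : Fin k → Fin m
    r′ a = lower (r a) (r<m a)
    c′ : Fin l → Fin n
    c′ b = lower (c b) (c<n b)
    r≡ : ∀ a → inject₁ (r′ a) ≡ r a
    r≡ a = Finₚ.inject₁-lower₁ (r a) _
    c≡ : ∀ b → inject₁ (c′ b) ≡ c b
    c≡ b = Finₚ.inject₁-lower₁ (c b) _

topLeft-setOne-Contains : {P : Matrix k l} (N : Matrix (suc m) (suc n)) (i : Fin m) (j : Fin n) →
  ContainsNW P (setOne N (inject₁ i) (inject₁ j)) (fromℕ m) (fromℕ n) →
  Contains P (setOne (topLeft N) i j)
topLeft-setOne-Contains N i j = Contains-mono (topLeft-setOne N i j) ∘ ContainsNW⇒topLeft-Contains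

extend : (Fin k → Fin m) → Fin m → Fin (suc k) → Fin m
extend r x i = maybe r x (initFin i)

module _ {r : Fin k → Fin m} {x : Fin m} where

  extend-inject₁ : ∀ a → extend r x (inject₁ a) ≡ r a
  extend-inject₁ a rewrite initFin-inject₁ a = refl

  extend-fromℕ : extend r x (fromℕ k) ≡ x
  extend-fromℕ rewrite initFin-fromℕ k = refl

  extend-increasing : StrictlyIncreasing r → (∀ a → r a < x) → StrictlyIncreasing (extend r x)
  extend-increasing r↑ r<x i j i<j with view i | view j
  ... | ‵inject₁ a | ‵inject₁ b =
    subst₂ _<_ (sym (extend-inject₁ a)) (sym (extend-inject₁ b)) (r↑ a b (inject₁-cancel-< i<j))
  ... | ‵inject₁ a | ‵fromℕ = subst₂ _<_ (sym (extend-inject₁ a)) (sym extend-fromℕ) (r<x a)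
  ... | ‵fromℕ     | _      = contradiction i<j (fromℕ≮ j)

  extend-< : ∀ {x′ : Fin m} → (∀ a → r a < x) → x < x′ → ∀ i → extend r x i < x′
  extend-< r<x x<x′ i with view i
  ... | ‵inject₁ a = subst (_< _) (sym (extend-inject₁ a)) (Finₚ.<-trans (r<x a) x<x′)
  ... | ‵fromℕ     = subst (_< _) (sym extend-fromℕ) x<x′

module _ {P : Matrix k l} {M : Matrix m n} where

  Copy-extend : ∀ {r c x y} → Copy P M r c → (∀ a → r a < x) → (∀ b → c b < y) → M x y ≡ true →
    Copy (ext P) M (extend r x) (extend c y)
  Copy-extend {r} {c} {x} {y} (r↑ , c↑ , ones) r<x c<y Mxy =
    extend-increasing r↑ r<x , extend-increasing c↑ c<y , ones′
    where
    entry : ∀ {i j a b} → extend r x i ≡ a → extend c y j ≡ b → M a b ≡ true →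
      M (extend r x i) (extend c y j) ≡ true
    entry ri≡a cj≡b = subst₂ (λ u v → M u v ≡ true) (sym ri≡a) (sym cj≡b)
    ones′ : ∀ i j → ext P i j ≡ true → M (extend r x i) (extend c y j) ≡ true
    ones′ i j e with view i | view j
    ... | ‵inject₁ a | ‵inject₁ b =
      entry (extend-inject₁ a) (extend-inject₁ b) (ones a b (trans (sym (ext-inject₁ P a b)) e))
    ... | ‵inject₁ a | ‵fromℕ     = contradiction (trans (sym e) (ext-lastColumn P a)) λ ()
    ... | ‵fromℕ     | ‵inject₁ b = contradiction (trans (sym e) (ext-lastRow P b)) λ ()
    ... | ‵fromℕ     | ‵fromℕ     = entry (extend-fromℕ {r = r}) (extend-fromℕ {r = c}) Mxy

  Contains-ext : ∀ {x y} → ContainsNW P M x y → M x y ≡ true → Contains (ext P) M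
  Contains-ext (containsNW r c copy r<x c<y) Mxy =
    extend r _ , extend c _ , Copy-extend copy r<x c<y Mxy

  ContainsNW-ext : ∀ {x y x′ y′} → ContainsNW P M x y → M x y ≡ true → x < x′ → y < y′ →
    ContainsNW (ext P) M x′ y′
  ContainsNW-ext (containsNW r c copy r<x c<y) Mxy x<x′ y<y′ =
    containsNW (extend r _) (extend c _) (Copy-extend copy r<x c<y Mxy)
      (extend-< r<x x<x′) (extend-< c<y y<y′)

  Copy-ext⁻¹ : ∀ {r c} → Copy (ext P) M r c →
    M (r (fromℕ k)) (c (fromℕ l)) ≡ true × ContainsNW P M (r (fromℕ k)) (c (fromℕ l))
  Copy-ext⁻¹ {r} {c} (r↑ , c↑ , ones) =
    ones (fromℕ k) (fromℕ l) (ext-corner P) ,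
    containsNW (r ∘ inject₁) (c ∘ inject₁)
      ((λ a b → r↑ _ _ ∘ inject₁-mono-<) , (λ a b → c↑ _ _ ∘ inject₁-mono-<) ,
       (λ a b → ones _ _ ∘ trans (ext-inject₁ P a b)))
      (λ a → r↑ _ _ (inject₁<fromℕ a)) (λ b → c↑ _ _ (inject₁<fromℕ b))

  Contains-ext⁻¹ : Contains (ext P) M → ∃₂ λ x y → M x y ≡ true × ContainsNW P M x y
  Contains-ext⁻¹ (r , c , copy) = r (fromℕ k) , c (fromℕ l) , Copy-ext⁻¹ copy

  ContainsNW-ext⁻¹ : ∀ {x′ y′} → ContainsNW (ext P) M x′ y′ →
    ∃₂ λ x y → x < x′ × y < y′ × M x y ≡ true × ContainsNW P M x y
  ContainsNW-ext⁻¹ (containsNW r c copy r<x′ c<y′) =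
    r (fromℕ k) , c (fromℕ l) , r<x′ _ , c<y′ _ , Copy-ext⁻¹ copy

module _ {Q : Matrix k l} {M : Matrix m n} {x : Fin m} {y : Fin n} where

  Contains-ext-setOne : Contains (ext Q) (setOne M x y) →
    ContainsNW Q M x y ⊎ ∃₂ λ u v → M u v ≡ true × ContainsNW Q (setOne M x y) u v
  Contains-ext-setOne Q⊑ with Contains-ext⁻¹ Q⊑
  ... | u , v , e , copy with setOne-true M x y {u} {v} e
  ...   | inj₁ (refl , refl) = inj₁ (ContainsNW-mono below copy)
    where
    below : setOne M x y ⊆[ x , y ] M
    below = setOne-⊆[] M x y (λ _ _ _ _ → id) λ x<x _ → contradiction x<x (Finₚ.<-irrefl refl)
  ...   | inj₂ Muv = inj₂ (u , v , Muv , copy)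

SouthEast : Matrix m n → Fin m → Fin n → Set
SouthEast M x y = ∃₂ λ u v → x < u × y < v × M u v ≡ true

southEast? : (M : Matrix m n) (x : Fin m) (y : Fin n) → Dec (SouthEast M x y)
southEast? M x y =
  Finₚ.any? λ u → Finₚ.any? λ v → x Finₚ.<? u ×-dec y Finₚ.<? v ×-dec M u v Bool.≟ true

southEast : Matrix m n → Matrix m n
southEast M x y = does (southEast? M x y)

core : Matrix m n → Matrix m n
core M x y = M x y ∧ southEast M x y

frontier : Matrix m n → Matrix m n
frontier M x y = M x y ∧ not (southEast M x y)

vacant : Matrix m n → Matrix m n
vacant M x y = not (M x y ∨ southEast M x y)

shrink : Matrix (suc m) (suc n) → Matrix m n
shrink M = topLeft (core M)

module _ (M : Matrix m n) where

  ¬SouthEast-↘ : ∀ {x y x′ y′} → ¬ SouthEast M x y → x < x′ → y < y′ →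
    M x′ y′ ≡ false × ¬ SouthEast M x′ y′
  ¬SouthEast-↘ ¬se x<x′ y<y′ =
    Boolₚ.¬-not (λ M′ → ¬se (_ , _ , x<x′ , y<y′ , M′)) ,
    λ (u , v , x′<u , y′<v , Muv) →
      ¬se (u , v , Finₚ.<-trans x<x′ x′<u , Finₚ.<-trans y<y′ y′<v , Muv)

  southEast-true⁻¹ : ∀ {x y} → southEast M x y ≡ true → SouthEast M x y
  southEast-true⁻¹ {x} {y} e with southEast? M x y
  ... | yes se = se

  core-true : ∀ {x y} → core M x y ≡ true → M x y ≡ true × SouthEast M x y
  core-true {x} {y} e with M x y | southEast? M x y
  ... | true | yes se = refl , se

  core-false : ∀ {x y} → core M x y ≡ false → M x y ≡ false ⊎ ¬ SouthEast M x y
  core-false {x} {y} e with M x y | southEast? M x y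
  ... | false | _      = inj₁ refl
  ... | true  | no ¬se = inj₂ ¬se

  ⊆[]-core : ∀ {u v} → M u v ≡ true → M ⊆[ u , v ] core M
  ⊆[]-core Muv x y x<u y<v Mxy rewrite Mxy = dec-true (southEast? M x y) (_ , _ , x<u , y<v , Muv)

  vacant-true : ∀ {x y} → M x y ≡ false → ¬ SouthEast M x y → vacant M x y ≡ true
  vacant-true {x} {y} Mxy ¬se rewrite Mxy | dec-false (southEast? M x y) ¬se = refl

  vacant-true⁻¹ : ∀ {x y} → vacant M x y ≡ true → M x y ≡ false × ¬ SouthEast M x y
  vacant-true⁻¹ {x} {y} e with M x y | southEast? M x y
  ... | false | no ¬se = refl , ¬se

  southEast-∨-vacant : ∀ {x y x′ y′} → x < x′ → y < y′ → southEast M x y ∨ vacant M x′ y′ ≡ true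
  southEast-∨-vacant {x} {y} x<x′ y<y′ with southEast? M x y
  ... | yes _  = refl
  ... | no ¬se = uncurry vacant-true (¬SouthEast-↘ ¬se x<x′ y<y′)

  frontier+southEast+vacant : ∀ x y →
    ind (frontier M x y) + (ind (southEast M x y) + ind (vacant M x y)) ≡ 1
  frontier+southEast+vacant x y with M x y | southEast M x y
  ... | true  | true  = refl
  ... | true  | false = refl
  ... | false | true  = refl
  ... | false | false = refl

module _ (M : Matrix (suc m) (suc n)) where

  southEast-lastRow : ∀ y → southEast M (fromℕ m) y ≡ false
  southEast-lastRow y = dec-false (southEast? M _ y) λ (u , _ , m<u , _) → fromℕ≮ u m<u

  southEast-lastColumn : ∀ x → southEast M x (fromℕ n) ≡ false
  southEast-lastColumn x = dec-false (southEast? M x _) λ (_ , v , _ , n<v , _) → fromℕ≮ v n<v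

  weight-shrink : weight M ≡ weight (shrink M) + weight (frontier M)
  weight-shrink = trans (weight-split M (southEast M))
    (cong (_+ weight (frontier M)) (weight-topLeft-≡ (core M)
      (λ x → trans (cong (M x (fromℕ n) ∧_) (southEast-lastColumn x)) (Boolₚ.∧-zeroʳ _))
      (λ y → trans (cong (M (fromℕ m) y ∧_) (southEast-lastRow y)) (Boolₚ.∧-zeroʳ _))))

saturating-vacant : {A : Matrix k l} {M : Matrix m n} → Saturating (ext A) M →
  ∀ {x y} → vacant M x y ≡ true → ContainsNW A M x y
saturating-vacant {M = M} (avoid , fill) {x} {y} V with vacant-true⁻¹ M V
... | Mxy , ¬se with Contains-ext-setOne (fill x y Mxy)
...   | inj₁ copy = copy
...   | inj₂ (u , v , Muv , copy) = contradiction (Contains-ext (ContainsNW-mono below copy) Muv) avoid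
  where
  below : setOne M x y ⊆[ u , v ] M
  below = setOne-⊆[] M x y (λ _ _ _ _ → id) λ x<u y<v → contradiction (u , v , x<u , y<v , Muv) ¬se

padOnes : Matrix m n → Matrix (suc m) (suc n)
padOnes M x y = maybe (λ i → maybe (M i) true (initFin y)) true (initFin x)

module _ (M : Matrix m n) where

  topLeft-padOnes : ∀ i j → topLeft (padOnes M) i j ≡ M i j
  topLeft-padOnes i j rewrite initFin-inject₁ i | initFin-inject₁ j = refl

  padOnes-lastRow : ∀ y → padOnes M (fromℕ m) y ≡ true
  padOnes-lastRow y rewrite initFin-fromℕ m = refl

  padOnes-lastColumn : ∀ x → padOnes M x (fromℕ n) ≡ true
  padOnes-lastColumn x with view x
  ... | ‵inject₁ i rewrite initFin-inject₁ i | initFin-fromℕ n = refl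
  ... | ‵fromℕ     = padOnes-lastRow (fromℕ n)

  weight-padOnes : weight (padOnes M) ≡ weight M + suc (m + n)
  weight-padOnes = begin
    weight (padOnes M)
      ≡⟨ weight-topLeft (padOnes M) ⟩
    weight (topLeft (padOnes M)) + (lastColumnWeight (padOnes M) + lastRowWeight (padOnes M))
      ≡⟨ cong₂ _+_ (Σ²-cong (λ i j → cong ind (topLeft-padOnes i j)))
           (cong₂ _+_ (sumFin-ones m (λ i → cong ind (padOnes-lastColumn _)))
                      (sumFin-ones (suc n) (λ j → cong ind (padOnes-lastRow j)))) ⟩
    weight M + (m + suc n)
      ≡⟨ cong (weight M +_) (ℕₚ.+-suc m n) ⟩
    weight M + suc (m + n) ∎
    where open ≡-Reasoning

module _ {Q : Matrix k l} {M : Matrix m n} where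

  padOnes-avoids : Avoids Q M → Avoids (ext Q) (padOnes M)
  padOnes-avoids avoid Q⊑ with Contains-ext⁻¹ {M = padOnes M} Q⊑
  ... | x , y , _ , copy =
    avoid (Contains-mono (λ i j → trans (sym (topLeft-padOnes M i j)))
      (ContainsNW⇒topLeft-Contains {N = padOnes M}
        (ContainsNW-weaken {M = padOnes M} (Finₚ.≤fromℕ x) (Finₚ.≤fromℕ y) copy)))

  padOnes-saturating : Saturating Q M → Saturating (ext Q) (padOnes M)
  padOnes-saturating (avoid , fill) = padOnes-avoids avoid , fill′
    where
    fill′ : ∀ x y → padOnes M x y ≡ false → Contains (ext Q) (setOne (padOnes M) x y)
    fill′ x y e with view x | view y
    ... | ‵inject₁ i | ‵inject₁ j =
      Contains-ext {M = N}
        (topLeft-Contains⇒ContainsNW {N = N}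
          (Contains-mono grown (fill i j (trans (sym (topLeft-padOnes M i j)) e))))
        (⊆-setOne (padOnes M) _ _ _ _ (padOnes-lastRow M (fromℕ n)))
      where
      N : Matrix (suc m) (suc n)
      N = setOne (padOnes M) (inject₁ i) (inject₁ j)
      grown : setOne M i j ⊆ topLeft N
      grown = setOne-⊆ M i j (λ i′ j′ → ⊆-setOne (padOnes M) _ _ _ _ ∘ trans (topLeft-padOnes M i′ j′))
                (setOne-target (padOnes M) _ _)
    ... | ‵inject₁ i | ‵fromℕ = contradiction (trans (sym e) (padOnes-lastColumn M _)) λ ()
    ... | ‵fromℕ     | _      = contradiction (trans (sym e) (padOnes-lastRow M _)) λ ()

module _ {A : Matrix k l} {M : Matrix (suc m) (suc n)} where

  shrink-avoids : Avoids (ext (ext A)) M → Avoids (ext A) (shrink M)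
  shrink-avoids avoid A⊑
    with Contains-ext⁻¹ {M = core M} (ContainsNW⇒Contains (topLeft-Contains⇒ContainsNW {N = core M} A⊑))
  ... | x , y , coreXY , copy with core-true M coreXY
  ...   | Mxy , (u , v , x<u , y<v , Muv) =
    avoid (Contains-ext (ContainsNW-ext (ContainsNW-mono (λ _ _ _ _ → proj₁ ∘ core-true M) copy)
                                        Mxy x<u y<v)
                        Muv)

  ⊆[]-setOne-core : ∀ {u v} x y → M u v ≡ true → M ⊆[ u , v ] setOne (core M) x y
  ⊆[]-setOne-core x y Muv x′ y′ x′<u y′<v = ⊆-setOne (core M) x y x′ y′ ∘ ⊆[]-core M Muv x′ y′ x′<u y′<v

  -- The last entry of the copy is a 1 of M weakly north-west of (i , j); moving it to (i , j)
  -- leaves every other entry a 1 of the core.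
  ContainsNW⇒Contains-setOne-shrink : ∀ i j → ContainsNW (ext A) M (suc i) (suc j) →
    Contains (ext A) (setOne (shrink M) i j)
  ContainsNW⇒Contains-setOne-shrink i j copy with ContainsNW-ext⁻¹ copy
  ... | x , y , x<i , y<j , Mxy , copyA =
    topLeft-setOne-Contains (core M) i j
      (ContainsNW-ext (ContainsNW-weaken (Finₚ.<⇒≤pred x<i) (Finₚ.<⇒≤pred y<j)
                                          (ContainsNW-mono (⊆[]-setOne-core _ _ Mxy) copyA))
                      (setOne-target (core M) _ _) (inject₁<fromℕ i) (inject₁<fromℕ j))

  ContainsNW-setOne⇒Contains-setOne-shrink : ∀ i j {u v} → M u v ≡ true →
    ContainsNW (ext A) (setOne M (inject₁ i) (inject₁ j)) u v → Contains (ext A) (setOne (shrink M) i j)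
  ContainsNW-setOne⇒Contains-setOne-shrink i j {u} {v} Muv copy =
    topLeft-setOne-Contains (core M) i j
      (ContainsNW-weaken (Finₚ.≤fromℕ u) (Finₚ.≤fromℕ v)
        (ContainsNW-mono (setOne-⊆[] M _ _ (⊆[]-setOne-core _ _ Muv) (λ _ _ → setOne-target (core M) _ _))
                         copy))

  shrink-saturating : Saturating (ext (ext A)) M → Saturating (ext A) (shrink M)
  shrink-saturating sat@(avoid , fill) = shrink-avoids avoid , fill′
    where
    fill′ : ∀ i j → shrink M i j ≡ false → Contains (ext A) (setOne (shrink M) i j)
    fill′ i j e with core-false M e
    ... | inj₂ ¬se = ContainsNW⇒Contains-setOne-shrink i j (saturating-vacant sat
            (uncurry (vacant-true M) (¬SouthEast-↘ M ¬se (inject₁<suc i) (inject₁<suc j))))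
    ... | inj₁ Mij with Contains-ext-setOne (fill _ _ Mij)
    ...   | inj₁ copy = ContainsNW⇒Contains-setOne-shrink i j
            (ContainsNW-weaken (ℕₚ.<⇒≤ (inject₁<suc i)) (ℕₚ.<⇒≤ (inject₁<suc j)) copy)
    ...   | inj₂ (u , v , Muv , copy) = ContainsNW-setOne⇒Contains-setOne-shrink i j Muv copy

module _ {a b : ℕ} (m n : ℕ) (a+b≡ : a + b ≡ suc m * suc n) where

  private
    square : suc m * suc n ≡ suc (m + n) + m * n
    square = solve 2 (λ m n → (con 1 :+ m) :* (con 1 :+ n) := (con 1 :+ (m :+ n)) :+ m :* n) refl m n
      where open +-*-Solver

  complement-≤ : m * n ℕ.≤ b → a ℕ.≤ suc (m + n)
  complement-≤ mn≤b = ℕₚ.+-cancelʳ-≤ (m * n) a (suc (m + n)) (begin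
    a + m * n            ≤⟨ ℕₚ.+-monoʳ-≤ a mn≤b ⟩
    a + b                ≡⟨ trans a+b≡ square ⟩
    suc (m + n) + m * n  ∎)
    where open ℕₚ.≤-Reasoning

  complement-≥ : b ℕ.≤ m * n → suc (m + n) ℕ.≤ a
  complement-≥ b≤mn = ℕₚ.+-cancelʳ-≤ (m * n) (suc (m + n)) a (begin
    suc (m + n) + m * n  ≡⟨ trans a+b≡ square ⟨
    a + b                ≤⟨ ℕₚ.+-monoʳ-≤ a b≤mn ⟩
    a + m * n            ∎)
    where open ℕₚ.≤-Reasoning

frontier-weight-≤ : (M : Matrix (suc m) (suc n)) → weight (frontier M) ℕ.≤ suc (m + n)
frontier-weight-≤ {m} {n} M =
  complement-≤ m n (weight-partition (frontier M) (southEast M) (vacant M) (frontier+southEast+vacant M))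
    (weight-shifted-∨ (southEast M) (vacant M)
      λ i j → southEast-∨-vacant M (inject₁<suc i) (inject₁<suc j))

saturating-frontier-weight-≥ : {A : Matrix k l} {M : Matrix (suc m) (suc n)} →
  Saturating (ext (ext A)) M → suc (m + n) ℕ.≤ weight (frontier M)
saturating-frontier-weight-≥ {m = m} {n} {M = M} sat@(avoid , _) =
  complement-≥ m n (weight-partition (frontier M) (southEast M) (vacant M) (frontier+southEast+vacant M))
    (weight-shifted-∧ (southEast M) (vacant M) separated
      (southEast-lastColumn M) (southEast-lastRow M) firstColumn firstRow)
  where
  separated : ∀ i j → southEast M (inject₁ i) (inject₁ j) ∧ vacant M (suc i) (suc j) ≡ false
  separated i j = Boolₚ.¬-not λ both →
    let (u , v , i<u , j<v , Muv) = southEast-true⁻¹ M (Boolₚ.∧-conicalˡ _ _ both)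
        copy = saturating-vacant sat (Boolₚ.∧-conicalʳ _ _ both)
    in avoid (Contains-ext (ContainsNW-weaken (inject₁<⇒suc≤ i<u) (inject₁<⇒suc≤ j<v) copy) Muv)
  firstColumn : ∀ x → vacant M x zero ≡ false
  firstColumn x = Boolₚ.¬-not λ V → ℕₚ.n≮0 (ContainsNW.columns< (saturating-vacant sat V) zero)
  firstRow : ∀ y → vacant M zero y ≡ false
  firstRow y = Boolₚ.¬-not λ V → ℕₚ.n≮0 (ContainsNW.rows< (saturating-vacant sat V) zero)

weight-≤-shrink : (M : Matrix (suc m) (suc n)) → weight M ℕ.≤ weight (shrink M) + suc (m + n)
weight-≤-shrink M =
  ℕₚ.≤-trans (ℕₚ.≤-reflexive (weight-shrink M)) (ℕₚ.+-monoʳ-≤ (weight (shrink M)) (frontier-weight-≤ M))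

saturating-weight-≥-shrink : {A : Matrix k l} {M : Matrix (suc m) (suc n)} →
  Saturating (ext (ext A)) M → weight (shrink M) + suc (m + n) ℕ.≤ weight M
saturating-weight-≥-shrink {M = M} sat =
  ℕₚ.≤-trans (ℕₚ.+-monoʳ-≤ (weight (shrink M)) (saturating-frontier-weight-≥ sat))
             (ℕₚ.≤-reflexive (sym (weight-shrink M)))

Maximum : {X : Set} → (X → ℕ) → (X → Set) → ℕ → Set
Maximum {X} w R e = (Σ X λ x → R x × w x ≡ e) × (∀ x → R x → w x ℕ.≤ e)

Minimum : {X : Set} → (X → ℕ) → (X → Set) → ℕ → Set
Minimum {X} w R e = (Σ X λ x → R x × w x ≡ e) × (∀ x → R x → e ℕ.≤ w x)

module _ {X Y : Set} {w : X → ℕ} {v : Y → ℕ} {R : X → Set} {S : Y → Set}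
         (grow : X → Y) (cut : Y → X) (d : ℕ)
         (grow-preserves : ∀ x → R x → S (grow x)) (cut-preserves : ∀ y → S y → R (cut y))
         (weight-grow : ∀ x → v (grow x) ≡ w x + d) where

  Maximum-shift : (∀ y → S y → v y ℕ.≤ w (cut y) + d) → ∀ e → Maximum w R e ⇔ Maximum v S (e + d)
  Maximum-shift weight-cut e = mk⇔ to from
    where
    to : Maximum w R e → Maximum v S (e + d)
    to ((x , Rx , wx≡e) , bound) =
      (grow x , grow-preserves x Rx , trans (weight-grow x) (cong (_+ d) wx≡e)) ,
      λ y Sy → ℕₚ.≤-trans (weight-cut y Sy) (ℕₚ.+-monoˡ-≤ d (bound (cut y) (cut-preserves y Sy)))
    from : Maximum v S (e + d) → Maximum w R e
    from ((y , Sy , vy≡e+d) , bound) =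
      (cut y , cut-preserves y Sy ,
       ℕₚ.≤-antisym (bound′ (cut y) (cut-preserves y Sy))
                    (ℕₚ.+-cancelʳ-≤ d _ _ (subst (ℕ._≤ _) vy≡e+d (weight-cut y Sy)))) ,
      bound′
      where
      bound′ : ∀ x → R x → w x ℕ.≤ e
      bound′ x Rx =
        ℕₚ.+-cancelʳ-≤ d _ _ (subst (ℕ._≤ _) (weight-grow x) (bound (grow x) (grow-preserves x Rx)))

  Minimum-shift : (∀ y → S y → w (cut y) + d ℕ.≤ v y) → ∀ e → Minimum w R e ⇔ Minimum v S (e + d)
  Minimum-shift weight-cut e = mk⇔ to from
    where
    to : Minimum w R e → Minimum v S (e + d)
    to ((x , Rx , wx≡e) , bound) =
      (grow x , grow-preserves x Rx , trans (weight-grow x) (cong (_+ d) wx≡e)) ,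
      λ y Sy → ℕₚ.≤-trans (ℕₚ.+-monoˡ-≤ d (bound (cut y) (cut-preserves y Sy))) (weight-cut y Sy)
    from : Minimum v S (e + d) → Minimum w R e
    from ((y , Sy , vy≡e+d) , bound) =
      (cut y , cut-preserves y Sy ,
       ℕₚ.≤-antisym (ℕₚ.+-cancelʳ-≤ d _ _ (subst (_ ℕ.≤_) vy≡e+d (weight-cut y Sy)))
                    (bound′ (cut y) (cut-preserves y Sy))) ,
      bound′
      where
      bound′ : ∀ x → R x → e ℕ.≤ w x
      bound′ x Rx =
        ℕₚ.+-cancelʳ-≤ d _ _ (subst (_ ℕ.≤_) (weight-grow x) (bound (grow x) (grow-preserves x Rx)))

theorem7 : {k l : ℕ} (A : Matrix k l) (m n : ℕ) →
    (∀ e → IsEx (ext A) m n e ⇔ IsEx (ext (ext A)) (suc m) (suc n) (e + suc m + suc n ∸ 1)) ×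
    (∀ s → IsSat (ext A) m n s ⇔ IsSat (ext (ext A)) (suc m) (suc n) (s + suc m + suc n ∸ 1))
theorem7 A m n =
  (λ e → subst (IsEx (ext A) m n e ⇔_) (cong (IsEx _ _ _) (sym (border e)))
    (Maximum-shift padOnes shrink (suc (m + n))
      (λ M → padOnes-avoids {M = M}) (λ M → shrink-avoids {M = M})
      weight-padOnes (λ M _ → weight-≤-shrink M) e)) ,
  (λ s → subst (IsSat (ext A) m n s ⇔_) (cong (IsSat _ _ _) (sym (border s)))
    (Minimum-shift padOnes shrink (suc (m + n))
      (λ M → padOnes-saturating {M = M}) (λ M → shrink-saturating {M = M})
      weight-padOnes (λ _ → saturating-weight-≥-shrink) s))
  where
  border : ∀ e → e + suc m + suc n ∸ 1 ≡ e + suc (m + n)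
  border e = trans (cong (_∸ 1) (ℕₚ.+-suc (e + suc m) n)) (ℕₚ.+-assoc e (suc m) n)
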